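{- Let $x$ and $y$ be nonempty p-strings with $\langle x[2..]\rangle < \langle y[2..]\rangle$, and let $\ell = \mathrm{lcp}(\langle x[2..]\rangle, \langle y[2..]\rangle)$ and $e = \mathrm{lcp}^{\infty}(\langle x[2..]\rangle, \langle y[2..]\rangle)$. Let $h = \mathsf{select}_{x[1]}(x[2..],1)$ and $h' = \mathsf{select}_{y[1]}(y[2..],1)$ (whenever these exist). Then: (A) Suppose at least one of $\mathrm{fce}(x), \mathrm{fce}(y)$ lies in $\Sigma_s$. (A1) If $\mathrm{fce}(x)\neq \mathrm{fce}(y)$, then $\mathrm{lcp}(\langle x\rangle,\langle y\rangle)=0$, $\mathrm{lcp}^\infty(\langle x\rangle,\langle y\rangle)=0$, and $\langle x\rangle<\langle y\rangle$ iff $\mathrm{fce}(x)<\mathrm{fce}(y)$. (A2) If $\mathrm{fce}(x)=\mathrm{fce}(y)$, then $\mathrm{lcp}(\langle x\rangle,\langle y\rangle)=\ell+1$, $\mathrm{lcp}^\infty(\langle x\rangle,\langle y\rangle)=e$, and $\langle x\rangle<\langle y\rangle$. (B) Suppose neither $\mathrm{fce}(x)$ nor $\mathrm{fce}(y)$ lies in $\Sigma_s$. (B1) If $\mathrm{fce}(x)=\mathrm{fce}(y)\le e$, then $\mathrm{lcp}(\langle x\rangle,\langle y\rangle)=\ell+1$, $\mathrm{lcp}^\infty(\langle x\rangle,\langle y\rangle)=e$, and $\langle x\rangle<\langle y\rangle$. (B2) If $\mathrm{fce}(x)\le e$ and $\mathrm{fce}(x)<\mathrm{fce}(y)$, then $\mathrm{lcp}(\langle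 x\rangle,\langle y\rangle)=h$, $\mathrm{lcp}^\infty(\langle x\rangle,\langle y\rangle)=\mathrm{fce}(x)$, and $\langle x\rangle<\langle y\rangle$. (B3) If $\mathrm{fce}(y)\le e$ and $\mathrm{fce}(y)<\mathrm{fce}(x)$, then $\mathrm{lcp}(\langle x\rangle,\langle y\rangle)=h'$, $\mathrm{lcp}^\infty(\langle x\rangle,\langle y\rangle)=\mathrm{fce}(y)$, and $\langle y\rangle<\langle x\rangle$. (B4) If $e<\min\{\mathrm{fce}(x),\mathrm{fce}(y)\}$, then $\mathrm{lcp}(\langle x\rangle,\langle y\rangle)=\ell+1$, $\mathrm{lcp}^\infty(\langle x\rangle,\langle y\rangle)=e+1$, and $\langle x\rangle<\langle y\rangle$.
   Context: $\Sigma_s$ (s-symbols) and $\Sigma_p$ (p-symbols) are disjoint alphabets; a p-string is a string over $\Sigma_s\cup\Sigma_p$. Strings are 1-indexed; $w[i..j]$ is the substring from position $i$ to $j$ (empty if $j<i$), $w[i..]=w[i..|w|]$, $w[..i]=w[1..i]$. $\infty$ is a symbol larger than every integer; $\mathbf{N}_\infty$ is the set of positive integers together with $\infty$. The alphabet $\Sigma_s\cup\mathbf{N}_\infty$ is totally ordered, with $\Sigma_s$ carrying its own order and every s-symbol smaller than every element of $\mathbf{N}_\infty$; strings are compared lexicographically ($x<y$ iff $x$ is a proper prefix of $y$ or $x$ is smaller at the first mismatching position). $\mathrm{lcp}(x,y)$ is the length of the longest common prefix of $x,y$. $\mathsf{select}_c(w,i)$ is the position of the $i$-th occurrence of $c$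 in $w$. The p-encoding $\langle w\rangle$ of a p-string $w$ is the string of length $|w|$ with $\langle w\rangle[i]=w[i]$ if $w[i]\in\Sigma_s$; $\langle w\rangle[i]=\infty$ if $w[i]\in\Sigma_p$ does not occur in $w[..i-1]$; and $\langle w\rangle[i]=i-j$ otherwise, where $j$ is the largest position in $[1..i-1]$ with $w[j]=w[i]$. $|w|_p$ is the number of distinct p-symbols in $w$. For a nonempty p-string $w$, $\mathrm{fce}(w)=w[1]$ if $w[1]\in\Sigma_s$, and otherwise $\mathrm{fce}(w)=|w[..h+1]|_p$ where $h+1=\min\{|w|,\mathsf{select}_{w[1]}(w,2)\}$; also $\mathrm{fce}(\varepsilon)=\$$, the smallest s-symbol. For p-strings $u,v$, $\mathrm{lcp}^\infty(\langle u\rangle,\langle v\rangle)$ is the number of occurrences of $\infty$ in the longest common prefix of $\langle u\rangle$ and $\langle v\rangle$. -}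

module Defs where

open import Data.Nat as ℕ using (ℕ; zero; suc; _⊓_)
open import Data.List using (List; []; _∷_; length; take; deduplicate)
open import Data.Maybe as Maybe using (Maybe; just; nothing)
open import Data.Sum using (_⊎_; inj₁; inj₂)
open import Data.Product using (∃; _,_)
open import Relation.Binary.PropositionalEquality using (_≡_; refl; cong)
open import Relation.Binary.Definitions using (DecidableEquality)
open import Relation.Binary.Structures using (IsStrictTotalOrder)
open import Relation.Nullary using (yes; no)

record PAlphabet : Set₁ where
  field
    S        : Set
    _<ₛ_     : S → S → Set
    <ₛ-isSTO : IsStrictTotalOrder _≡_ _<ₛ_
    $        : S
    $-least  : ∀ a → $ ≡ a ⊎ $ <ₛ a
    P        : Set
    _≟ₚ_     : DecidableEquality P

module PStrings (A : PAlphabet) where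
  open PAlphabet A
  open IsStrictTotalOrder <ₛ-isSTO using () renaming (_≟_ to _≟ₛ_)

  data Char : Set where
    sc : S → Char
    pc : P → Char

  _≟ᶜ_ : DecidableEquality Char
  sc a ≟ᶜ sc b with a ≟ₛ b
  ... | yes refl = yes refl
  ... | no ¬p = no λ { refl → ¬p refl }
  sc a ≟ᶜ pc b = no λ ()
  pc a ≟ᶜ sc b = no λ ()
  pc a ≟ᶜ pc b with a ≟ₚ b
  ... | yes refl = yes refl
  ... | no ¬p = no λ { refl → ¬p refl }

  PString : Set
  PString = List Char

  data Sym : Set where
    sym : S → Sym
    num : ℕ → Sym
    ∞   : Sym

  data _<ᵉ_ : Sym → Sym → Set where
    s<s : ∀ {a b} → a <ₛ b → sym a <ᵉ sym b
    s<n : ∀ {a i} → sym a <ᵉ num i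
    s<∞ : ∀ {a} → sym a <ᵉ ∞
    n<n : ∀ {i j} → i ℕ.< j → num i <ᵉ num j
    n<∞ : ∀ {i} → num i <ᵉ ∞

  _≤ᵉ_ : Sym → Sym → Set
  u ≤ᵉ v = u <ᵉ v ⊎ u ≡ v

  _≟ᵉ_ : DecidableEquality Sym
  sym a ≟ᵉ sym b with a ≟ₛ b
  ... | yes refl = yes refl
  ... | no ¬p = no λ { refl → ¬p refl }
  sym a ≟ᵉ num j = no λ ()
  sym a ≟ᵉ ∞ = no λ ()
  num i ≟ᵉ sym b = no λ ()
  num i ≟ᵉ num j with i ℕ.≟ j
  ... | yes refl = yes refl
  ... | no ¬p = no λ { refl → ¬p refl }
  num i ≟ᵉ ∞ = no λ ()
  ∞ ≟ᵉ sym b = no λ ()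
  ∞ ≟ᵉ num j = no λ ()
  ∞ ≟ᵉ ∞ = yes refl

  IsS : Sym → Set
  IsS u = ∃ λ a → u ≡ sym a

  data _<ₗ_ : List Sym → List Sym → Set where
    []<∷  : ∀ {b v} → [] <ₗ (b ∷ v)
    head< : ∀ {a b u v} → a <ᵉ b → (a ∷ u) <ₗ (b ∷ v)
    tail< : ∀ {a u v} → u <ₗ v → (a ∷ u) <ₗ (a ∷ v)

  -- select c w i : 1-based position of the i-th occurrence of c in w
  select : Char → PString → ℕ → Maybe ℕ
  select c w zero = nothing
  select c [] (suc i) = nothing
  select c (d ∷ w) (suc i) with c ≟ᶜ d | i
  ... | yes _ | zero  = just 1
  ... | yes _ | suc k = Maybe.map suc (select c w (suc k))
  ... | no _  | _     = Maybe.map suc (select c w (suc i))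

  -- p-encoding.  encGo r w encodes w given the already-read prefix in
  -- reverse order r; for a p-symbol c, the distance i - j to its previous
  -- occurrence j is the position of the first occurrence of c in r.
  encSym : PString → Char → Sym
  encSym r (sc a) = sym a
  encSym r (pc a) = Maybe.maybe num ∞ (select (pc a) r 1)

  encGo : PString → PString → List Sym
  encGo r [] = []
  encGo r (c ∷ w) = encSym r c ∷ encGo (c ∷ r) w

  ⟨_⟩ : PString → List Sym
  ⟨ w ⟩ = encGo [] w

  pSyms : PString → List P
  pSyms [] = []
  pSyms (sc _ ∷ w) = pSyms w
  pSyms (pc a ∷ w) = a ∷ pSyms w

  ∣_∣ₚ : PString → ℕ
  ∣ w ∣ₚ = length (deduplicate _≟ₚ_ (pSyms w))

  -- fce; for w[1] ∈ Σp, h+1 = min{|w|, select_{w[1]}(w,2)}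
  -- (= |w| when the second occurrence does not exist)
  fce : PString → Sym
  fce [] = sym $
  fce (sc a ∷ w) = sym a
  fce (pc a ∷ w) =
    num ∣ take (Maybe.maybe (λ k → k ⊓ length (pc a ∷ w)) (length (pc a ∷ w))
                            (select (pc a) (pc a ∷ w) 2))
               (pc a ∷ w) ∣ₚ

  commonPrefix : List Sym → List Sym → List Sym
  commonPrefix (a ∷ u) (b ∷ v) with a ≟ᵉ b
  ... | yes _ = a ∷ commonPrefix u v
  ... | no _  = []
  commonPrefix _ _ = []

  count∞ : List Sym → ℕ
  count∞ [] = 0
  count∞ (∞ ∷ u) = suc (count∞ u)
  count∞ (_ ∷ u) = count∞ u

  lcp : List Sym → List Sym → ℕ
  lcp u v = length (commonPrefix u v)

  lcp∞ : List Sym → List Sym → ℕ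
  lcp∞ u v = count∞ (commonPrefix u v)

module Submission where

-- If x[1] is an s-symbol, ⟨x⟩ is x[1] followed by ⟨x[2..]⟩. If x[1] = α is a p-symbol, ⟨x⟩ is ∞ followed
-- by ⟨x[2..]⟩ with one change: the ∞ recording the first recurrence of α, say the i-th ∞ (from 0), becomes
-- its distance to position 1. The distinct p-symbols up to that recurrence are α and the i symbols introduced
-- by the earlier ∞'s, so fce(x) = i + 1. Comparing ⟨x⟩ with ⟨y⟩ thus means comparing ⟨x[2..]⟩ and ⟨y[2..]⟩
-- after replacing their i-th and j-th ∞. Inside the common prefix (rank below e) the replacements either
-- coincide (i = j) or the earlier one creates the first mismatch, a distance against an ∞. Beyond it the
-- common prefix survives and the old mismatch still decides, because an ∞ replaced at index k becomes a
-- distance larger than any distance that can occur at index k.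

open import Defs
open import Data.Nat using (ℕ; zero; suc; _+_; _≤_; _<_; _⊓_; z≤n; s≤s)
open import Data.Nat.Properties using (+-suc; suc-injective; +-identityʳ; ≤-refl; ≤-trans; <⇒≤; <-irrefl)
open import Data.List using (List; []; _∷_; _++_; _∷ʳ_; _ʳ++_; length; take; filter; deduplicate)
open import Data.List.Properties using (filter-≐; filter-idem; filter-all; take-take; take-all; length-ʳ++)
open import Data.Maybe as Maybe using (just; nothing)
open import Data.Sum using (_⊎_; inj₁; inj₂)
open import Data.Product using (_×_; _,_; proj₁; proj₂)
open import Data.Maybe.Properties using (map-injective; map-nothing)
open import Data.Empty using (⊥-elim)
open import Function using (_∘_; _$_; case_of_)
open import Function.Bundles using (_⇔_; mk⇔)
open import Relation.Binary.Definitions using (DecidableEquality)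
open import Relation.Binary.Structures using (IsStrictTotalOrder)
open import Relation.Binary.PropositionalEquality as ≡ hiding (sym)
open import Relation.Nullary using (¬_; Dec; yes; no; ¬?)
open import Relation.Nullary.Decidable using (_×-dec_)
open import Relation.Unary using (Pred; Decidable; _≐_)
import Data.List.Relation.Unary.All as All

module _ {a} {X : Set a} where

  filter-filter : ∀ {p q r} {P : Pred X p} {Q : Pred X q} {R : Pred X r}
    (P? : Decidable P) (Q? : Decidable Q) (R? : Decidable R) →
    (∀ {x} → R x → P x × Q x) → (∀ {x} → P x → Q x → R x) →
    ∀ xs → filter P? (filter Q? xs) ≡ filter R? xs
  filter-filter P? Q? R? R⇒PQ PQ⇒R [] = refl
  filter-filter P? Q? R? R⇒PQ PQ⇒R (x ∷ xs) with Q? x | R? x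
  ... | no ¬q | yes r = ⊥-elim (¬q (proj₂ (R⇒PQ r)))
  ... | no _  | no _  = filter-filter P? Q? R? R⇒PQ PQ⇒R xs
  ... | yes q | yes r with P? x
  ...   | yes _ = cong (x ∷_) (filter-filter P? Q? R? R⇒PQ PQ⇒R xs)
  ...   | no ¬p = ⊥-elim (¬p (proj₁ (R⇒PQ r)))
  filter-filter P? Q? R? R⇒PQ PQ⇒R (x ∷ xs) | yes q | no ¬r with P? x
  ...   | yes p = ⊥-elim (¬r (PQ⇒R p q))
  ...   | no _  = filter-filter P? Q? R? R⇒PQ PQ⇒R xs

  filter-comm : ∀ {p q} {P : Pred X p} {Q : Pred X q} (P? : Decidable P) (Q? : Decidable Q) →
    ∀ xs → filter P? (filter Q? xs) ≡ filter Q? (filter P? xs)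
  filter-comm P? Q? xs =
    trans (filter-filter P? Q? (λ x → P? x ×-dec Q? x) (λ pq → pq) _,_ xs)
          (≡.sym (filter-filter Q? P? (λ x → P? x ×-dec Q? x) (λ (p , q) → q , p) (λ q p → p , q) xs))

  take-⊓-length : ∀ k (xs : List X) → take (k ⊓ length xs) xs ≡ take k xs
  take-⊓-length k xs =
    trans (≡.sym (take-take k (length xs) xs)) (cong (take k) (take-all (length xs) xs ≤-refl))

  take-∷ʳ : ∀ (u : List X) x v → take (suc (length u)) (u ++ x ∷ v) ≡ u ∷ʳ x
  take-∷ʳ [] x v = refl
  take-∷ʳ (y ∷ u) x v = cong (y ∷_) (take-∷ʳ u x v)

  ʳ++-++ : ∀ (u : List X) r t → u ʳ++ (r ++ t) ≡ (u ʳ++ r) ++ t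
  ʳ++-++ [] r t = refl
  ʳ++-++ (x ∷ u) r t = ʳ++-++ u (x ∷ r) t

  module _ (_≟_ : DecidableEquality X) where

    filter-deduplicate : ∀ y xs →
      filter (¬? ∘ (y ≟_)) (deduplicate _≟_ xs) ≡ deduplicate _≟_ (filter (¬? ∘ (y ≟_)) xs)
    filter-deduplicate y [] = refl
    filter-deduplicate y (x ∷ xs) with y ≟ x
    ... | yes refl = trans (filter-idem (¬? ∘ (y ≟_)) (deduplicate _≟_ xs)) (filter-deduplicate y xs)
    ... | no _ = cong (x ∷_) (trans (filter-comm (¬? ∘ (y ≟_)) (¬? ∘ (x ≟_)) (deduplicate _≟_ xs))
                                    (cong (filter (¬? ∘ (x ≟_))) (filter-deduplicate y xs)))

module _ {A : PAlphabet} where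
  open PAlphabet A
  open PStrings A

  Fresh : Char → PString → Set
  Fresh c w = select c w 1 ≡ nothing

  select-here : ∀ c w → select c (c ∷ w) 1 ≡ just 1
  select-here c w with c ≟ᶜ c
  ... | yes _ = refl
  ... | no c≢c = ⊥-elim (c≢c refl)

  select-there : ∀ {c} d w → c ≢ d → select c (d ∷ w) 1 ≡ Maybe.map suc (select c w 1)
  select-there {c} d w c≢d with c ≟ᶜ d
  ... | yes c≡d = ⊥-elim (c≢d c≡d)
  ... | no _ = refl

  select-second : ∀ c w → select c (c ∷ w) 2 ≡ Maybe.map suc (select c w 1)
  select-second c w with c ≟ᶜ c
  ... | yes _ = refl
  ... | no c≢c = ⊥-elim (c≢c refl)

  fresh-∷⁻ : ∀ {c} d w → Fresh c (d ∷ w) → c ≢ d × Fresh c w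
  fresh-∷⁻ {c} d w fresh with c ≟ᶜ d
  ... | yes _ = case fresh of λ ()
  ... | no c≢d = c≢d , map-injective suc-injective fresh

  fresh-∷⁺ : ∀ {c} d w → c ≢ d → Fresh c w → Fresh c (d ∷ w)
  fresh-∷⁺ d w c≢d fresh = trans (select-there d w c≢d) (map-nothing fresh)

  fresh-[] : ∀ c d → Fresh c (d ∷ []) ⊎ c ≡ d
  fresh-[] c d with c ≟ᶜ d
  ... | yes c≡d = inj₂ c≡d
  ... | no _ = inj₁ refl

  fresh-ʳ++ : ∀ {c} u r → Fresh c u → Fresh c r → Fresh c (u ʳ++ r)
  fresh-ʳ++ [] r _ fresh-r = fresh-r
  fresh-ʳ++ (d ∷ u) r fresh-du fresh-r =
    let c≢d , fresh-u = fresh-∷⁻ d u fresh-du in fresh-ʳ++ u (d ∷ r) fresh-u (fresh-∷⁺ d r c≢d fresh-r)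

  fresh-++ : ∀ {c} r t → Fresh c r → Fresh c t → Fresh c (r ++ t)
  fresh-++ [] t _ fresh-t = fresh-t
  fresh-++ (d ∷ r) t fresh-dr fresh-t =
    let c≢d , fresh-r = fresh-∷⁻ d r fresh-dr in fresh-∷⁺ d (r ++ t) c≢d (fresh-++ r t fresh-r fresh-t)

  select-++-found : ∀ {c k} r t → select c r 1 ≡ just k → select c (r ++ t) 1 ≡ just k
  select-++-found {c} (d ∷ r) t found with c ≟ᶜ d
  ... | yes _ = found
  ... | no _ with select c r 1 in eq
  select-++-found (d ∷ r) t refl | no _ | just k rewrite select-++-found r t eq = refl

  select-first : ∀ {c} u v → Fresh c u → select c (u ++ c ∷ v) 1 ≡ just (suc (length u))
  select-first {c} [] v _ = select-here c v
  select-first {c} (d ∷ u) v fresh-du =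
    let c≢d , fresh-u = fresh-∷⁻ {c} d u fresh-du in
    trans (select-there d (u ++ _ ∷ v) c≢d) (cong (Maybe.map suc) (select-first u v fresh-u))

  select≤length : ∀ {c n} r → select c r 1 ≡ just n → n ≤ length r
  select≤length {c} (d ∷ r) found with c ≟ᶜ d
  select≤length (d ∷ r) refl | yes _ = s≤s z≤n
  ... | no _ with select c r 1 in eq
  select≤length (d ∷ r) refl | no _ | just k = s≤s (select≤length r eq)

  data Occurrence (c : Char) : PString → Set where
    absent : ∀ {w} → Fresh c w → Occurrence c w
    first  : ∀ u v → Fresh c u → Occurrence c (u ++ c ∷ v)

  occurrence : ∀ c w → Occurrence c w
  occurrence c [] = absent refl
  occurrence c (d ∷ w) with c ≟ᶜ d
  ... | yes refl = first [] w refl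
  ... | no c≢d with occurrence c w
  ...   | absent fresh = absent (fresh-∷⁺ d w c≢d fresh)
  ...   | first u v fresh = first (d ∷ u) v (fresh-∷⁺ d u c≢d fresh)

  encGo-++ : ∀ r u w → encGo r (u ++ w) ≡ encGo r u ++ encGo (u ʳ++ r) w
  encGo-++ r [] w = refl
  encGo-++ r (c ∷ u) w = cong (encSym r c ∷_) (encGo-++ (c ∷ r) u w)

  length-encGo : ∀ r w → length (encGo r w) ≡ length w
  length-encGo r [] = refl
  length-encGo r (c ∷ w) = cong suc (length-encGo (c ∷ r) w)

  Irrelevant : PString → PString → PString → Set
  Irrelevant r t w = ∀ β → Fresh (pc β) r → Fresh (pc β) t ⊎ Fresh (pc β) w

  encGo-++-irrelevant : ∀ r t w → Irrelevant r t w → encGo (r ++ t) w ≡ encGo r w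
  encGo-++-irrelevant r t [] _ = refl
  encGo-++-irrelevant r t (c ∷ w) irr =
    cong₂ _∷_ (head c irr) (encGo-++-irrelevant (c ∷ r) t w tail)
    where
    head : ∀ c → Irrelevant r t (c ∷ w) → encSym (r ++ t) c ≡ encSym r c
    head (sc _) _ = refl
    head (pc β) irr with select (pc β) r 1 in found
    ... | just k rewrite select-++-found r t found = refl
    ... | nothing with irr β found
    ...   | inj₁ fresh-t rewrite fresh-++ r t found fresh-t = refl
    ...   | inj₂ fresh-w = case trans (≡.sym (select-here (pc β) w)) fresh-w of λ ()

    tail : Irrelevant (c ∷ r) t w
    tail β fresh-cr with fresh-∷⁻ c r fresh-cr
    ... | _ , fresh-r with irr β fresh-r
    ...   | inj₁ fresh-t = inj₁ fresh-t
    ...   | inj₂ fresh-cw = inj₂ (proj₂ (fresh-∷⁻ c w fresh-cw))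

  encGo-after-s : ∀ s w → encGo (sc s ∷ []) w ≡ ⟨ w ⟩
  encGo-after-s s w = encGo-++-irrelevant [] (sc s ∷ []) w irrelevant
    where
    irrelevant : Irrelevant [] (sc s ∷ []) w
    irrelevant β _ with fresh-[] (pc β) (sc s)
    ... | inj₁ fresh = inj₁ fresh

  encGo-after-absent : ∀ {α} w → Fresh (pc α) w → encGo (pc α ∷ []) w ≡ ⟨ w ⟩
  encGo-after-absent {α} w fresh = encGo-++-irrelevant [] (pc α ∷ []) w irrelevant
    where
    irrelevant : Irrelevant [] (pc α ∷ []) w
    irrelevant β _ with fresh-[] (pc β) (pc α)
    ... | inj₁ fresh-α = inj₁ fresh-α
    ... | inj₂ refl = inj₂ fresh

  encode-first : ∀ {α} u v → Fresh (pc α) u →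
    ⟨ u ++ pc α ∷ v ⟩ ≡ ⟨ u ⟩ ++ ∞ ∷ encGo (pc α ∷ u ʳ++ []) v
  encode-first {α} u v fresh
    rewrite encGo-++ [] u (pc α ∷ v) | fresh-ʳ++ u [] fresh (refl {x = nothing}) = refl

  encGo-after-first : ∀ {α} u v → Fresh (pc α) u →
    encGo (pc α ∷ []) (u ++ pc α ∷ v) ≡ ⟨ u ⟩ ++ num (suc (length u)) ∷ encGo (pc α ∷ u ʳ++ []) v
  encGo-after-first {α} u v fresh = begin
    encGo (pc α ∷ []) (u ++ pc α ∷ v)                            ≡⟨ encGo-++ (pc α ∷ []) u (pc α ∷ v) ⟩
    encGo (pc α ∷ []) u ++ encGo (u ʳ++ pc α ∷ []) (pc α ∷ v)    ≡⟨ cong₂ (λ U R′ → U ++ encGo R′ (pc α ∷ v))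
                                                                       (encGo-after-absent u fresh)
                                                                       (ʳ++-++ u [] (pc α ∷ [])) ⟩
    ⟨ u ⟩ ++ encSym (R ++ pc α ∷ []) (pc α) ∷ encGo (pc α ∷ R ++ pc α ∷ []) v
                                                                 ≡⟨ cong₂ (λ d T → ⟨ u ⟩ ++ d ∷ T) back-reference
                                                                       (encGo-++-irrelevant (pc α ∷ R) (pc α ∷ []) v seen) ⟩
    ⟨ u ⟩ ++ num (suc (length u)) ∷ encGo (pc α ∷ R) v           ∎
    where
    open ≡-Reasoning
    R : PString
    R = u ʳ++ []
    fresh-R : Fresh (pc α) R
    fresh-R = fresh-ʳ++ u [] fresh refl
    seen : Irrelevant (pc α ∷ R) (pc α ∷ []) v
    seen β fresh-αR = inj₁ (fresh-∷⁺ {pc β} (pc α) [] (proj₁ (fresh-∷⁻ (pc α) R fresh-αR)) refl)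
    back-reference : encSym (R ++ pc α ∷ []) (pc α) ≡ num (suc (length u))
    back-reference rewrite select-first R [] fresh-R | length-ʳ++ u {[]} | +-identityʳ (length u) = refl

  data DistancesBelow : ℕ → List Sym → Set where
    []   : ∀ {p} → DistancesBelow p []
    sym∷ : ∀ {p s L} → DistancesBelow (suc p) L → DistancesBelow p (sym s ∷ L)
    num∷ : ∀ {p n L} → n < p → DistancesBelow (suc p) L → DistancesBelow p (num n ∷ L)
    ∞∷   : ∀ {p L} → DistancesBelow (suc p) L → DistancesBelow p (∞ ∷ L)

  encGo-distancesBelow : ∀ r w → DistancesBelow (suc (length r)) (encGo r w)
  encGo-distancesBelow r [] = []
  encGo-distancesBelow r (sc s ∷ w) = sym∷ (encGo-distancesBelow (sc s ∷ r) w)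
  encGo-distancesBelow r (pc β ∷ w) with select (pc β) r 1 in found
  ... | just n = num∷ (s≤s (select≤length r found)) (encGo-distancesBelow (pc β ∷ r) w)
  ... | nothing = ∞∷ (encGo-distancesBelow (pc β ∷ r) w)

  New : PString → Pred P _
  New r β = Fresh (pc β) r

  new? : (r : PString) → Decidable (New r)
  new? r β with select (pc β) r 1
  ... | just _ = no λ ()
  ... | nothing = yes refl

  New-∷-≐ : ∀ d r → (∀ {β} → pc β ≡ d → ¬ Fresh d r) → New (d ∷ r) ≐ New r
  New-∷-≐ d r seen = (λ {β} → proj₂ ∘ fresh-∷⁻ {pc β} d r) , λ {β} → fresh (pc β ≟ᶜ d)
    where
    fresh : ∀ {β} → Dec (pc β ≡ d) → Fresh (pc β) r → Fresh (pc β) (d ∷ r)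
    fresh (yes refl) fresh-r = ⊥-elim (seen refl fresh-r)
    fresh (no β≢d) fresh-r = fresh-∷⁺ d r β≢d fresh-r

  dedupₚ : List P → List P
  dedupₚ = deduplicate _≟ₚ_

  distinctNew : PString → PString → ℕ
  distinctNew r w = length (dedupₚ (filter (new? r) (pSyms w)))

  distinctNew-≐ : ∀ r′ r w → New r′ ≐ New r → distinctNew r′ w ≡ distinctNew r w
  distinctNew-≐ r′ r w r′≐r = cong (length ∘ dedupₚ) (filter-≐ (new? r′) (new? r) r′≐r (pSyms w))

  count∞-encGo : ∀ r w → count∞ (encGo r w) ≡ distinctNew r w
  count∞-encGo r [] = refl
  count∞-encGo r (sc s ∷ w) =
    trans (count∞-encGo (sc s ∷ r) w) (distinctNew-≐ (sc s ∷ r) r w (New-∷-≐ (sc s) r λ ()))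
  count∞-encGo r (pc β ∷ w) with select (pc β) r 1 in found
  ... | just _ =
    trans (count∞-encGo (pc β ∷ r) w) (distinctNew-≐ (pc β ∷ r) r w (New-∷-≐ (pc β) r seen))
    where
    seen : ∀ {γ} → pc γ ≡ pc β → ¬ Fresh (pc β) r
    seen _ fresh = case trans (≡.sym found) fresh of λ ()
  ... | nothing = cong suc (begin
    count∞ (encGo (pc β ∷ r) w)                                   ≡⟨ count∞-encGo (pc β ∷ r) w ⟩
    length (dedupₚ (filter (new? (pc β ∷ r)) ws))                 ≡⟨ cong (length ∘ dedupₚ) new-after-β ⟨
    length (dedupₚ (filter (¬? ∘ (β ≟ₚ_)) new-after-r))           ≡⟨ cong length (filter-deduplicate _≟ₚ_ β new-after-r) ⟨
    length (filter (¬? ∘ (β ≟ₚ_)) (dedupₚ new-after-r))           ∎)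
    where
    open ≡-Reasoning
    ws new-after-r : List P
    ws = pSyms w
    new-after-r = filter (new? r) ws
    new-after-β : filter (¬? ∘ (β ≟ₚ_)) new-after-r ≡ filter (new? (pc β ∷ r)) ws
    new-after-β = filter-filter _ (new? r) (new? (pc β ∷ r))
      (λ {γ} fresh → let γ≢β , fresh-r = fresh-∷⁻ {pc γ} (pc β) r fresh
                     in (λ { refl → γ≢β refl }) , fresh-r)
      (λ β≢γ fresh-r → fresh-∷⁺ (pc β) r (λ { refl → β≢γ refl }) fresh-r)
      ws

  ∣∣ₚ≡count∞ : ∀ w → ∣ w ∣ₚ ≡ count∞ ⟨ w ⟩
  ∣∣ₚ≡count∞ w = ≡.sym (trans (count∞-encGo [] w) everything-new)
    where
    everything-new : distinctNew [] w ≡ ∣ w ∣ₚ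
    everything-new = cong (length ∘ dedupₚ) (filter-all (new? []) (All.universal (λ _ → refl) (pSyms w)))

  count∞-++ : ∀ U V → count∞ (U ++ V) ≡ count∞ U + count∞ V
  count∞-++ [] V = refl
  count∞-++ (sym _ ∷ U) V = count∞-++ U V
  count∞-++ (num _ ∷ U) V = count∞-++ U V
  count∞-++ (∞ ∷ U) V = cong suc (count∞-++ U V)

  -- replace∞ i p L turns the i-th ∞ of L (counting from 0) at index k into num (p + k).
  replace∞ : ℕ → ℕ → List Sym → List Sym
  replace∞ i p [] = []
  replace∞ i p (sym s ∷ L) = sym s ∷ replace∞ i (suc p) L
  replace∞ i p (num n ∷ L) = num n ∷ replace∞ i (suc p) L
  replace∞ zero p (∞ ∷ L) = num p ∷ L
  replace∞ (suc i) p (∞ ∷ L) = ∞ ∷ replace∞ i (suc p) L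

  index∞ : ℕ → List Sym → ℕ
  index∞ i [] = 0
  index∞ i (sym _ ∷ L) = suc (index∞ i L)
  index∞ i (num _ ∷ L) = suc (index∞ i L)
  index∞ zero (∞ ∷ L) = 0
  index∞ (suc i) (∞ ∷ L) = suc (index∞ i L)

  replace∞-beyond : ∀ i p L → count∞ L ≤ i → replace∞ i p L ≡ L
  replace∞-beyond i p [] _ = refl
  replace∞-beyond i p (sym s ∷ L) L≤i = cong (sym s ∷_) (replace∞-beyond i (suc p) L L≤i)
  replace∞-beyond i p (num n ∷ L) L≤i = cong (num n ∷_) (replace∞-beyond i (suc p) L L≤i)
  replace∞-beyond (suc i) p (∞ ∷ L) (s≤s L≤i) = cong (∞ ∷_) (replace∞-beyond i (suc p) L L≤i)

  replace∞-split : ∀ U T p → replace∞ (count∞ U) p (U ++ ∞ ∷ T) ≡ U ++ num (p + length U) ∷ T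
  replace∞-split [] T p = cong (λ k → num k ∷ T) (≡.sym (+-identityʳ p))
  replace∞-split (a ∷ U) T p = begin
    replace∞ (count∞ (a ∷ U)) p (a ∷ U ++ ∞ ∷ T)    ≡⟨ step a ⟩
    a ∷ replace∞ (count∞ U) (suc p) (U ++ ∞ ∷ T)    ≡⟨ cong (a ∷_) (replace∞-split U T (suc p)) ⟩
    a ∷ U ++ num (suc p + length U) ∷ T              ≡⟨ cong (λ k → a ∷ U ++ num k ∷ T) (≡.sym (+-suc p (length U))) ⟩
    a ∷ U ++ num (p + suc (length U)) ∷ T            ∎
    where
    open ≡-Reasoning
    step : ∀ a →
      replace∞ (count∞ (a ∷ U)) p (a ∷ U ++ ∞ ∷ T) ≡ a ∷ replace∞ (count∞ U) (suc p) (U ++ ∞ ∷ T)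
    step (sym _) = refl
    step (num _) = refl
    step ∞ = refl

  index∞-split : ∀ U T → index∞ (count∞ U) (U ++ ∞ ∷ T) ≡ length U
  index∞-split [] T = refl
  index∞-split (sym _ ∷ U) T = cong suc (index∞-split U T)
  index∞-split (num _ ∷ U) T = cong suc (index∞-split U T)
  index∞-split (∞ ∷ U) T = cong suc (index∞-split U T)

  length-replace∞ : ∀ i p L → length (replace∞ i p L) ≡ length L
  length-replace∞ i p [] = refl
  length-replace∞ i p (sym _ ∷ L) = cong suc (length-replace∞ i (suc p) L)
  length-replace∞ i p (num _ ∷ L) = cong suc (length-replace∞ i (suc p) L)
  length-replace∞ zero p (∞ ∷ L) = refl
  length-replace∞ (suc i) p (∞ ∷ L) = cong suc (length-replace∞ i (suc p) L)

  count∞-replace∞ : ∀ i p L → i < count∞ L → suc (count∞ (replace∞ i p L)) ≡ count∞ L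
  count∞-replace∞ i p (sym _ ∷ L) i<L = count∞-replace∞ i (suc p) L i<L
  count∞-replace∞ i p (num _ ∷ L) i<L = count∞-replace∞ i (suc p) L i<L
  count∞-replace∞ zero p (∞ ∷ L) _ = refl
  count∞-replace∞ (suc i) p (∞ ∷ L) (s≤s i<L) = cong suc (count∞-replace∞ i (suc p) L i<L)

  fce-pc-absent : ∀ α x → Fresh (pc α) x → fce (pc α ∷ x) ≡ num ∣ pc α ∷ x ∣ₚ
  fce-pc-absent α x fresh rewrite select-second (pc α) x | fresh =
    cong (λ w → num ∣ w ∣ₚ) (take-all _ (pc α ∷ x) ≤-refl)

  fce-pc-recurring : ∀ α x {k} → select (pc α) x 1 ≡ just k →
    fce (pc α ∷ x) ≡ num ∣ take (suc k) (pc α ∷ x) ∣ₚ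
  fce-pc-recurring α x {k} found rewrite select-second (pc α) x | found =
    cong (λ w → num ∣ w ∣ₚ) (take-⊓-length (suc k) (pc α ∷ x))

  record PHeadView (α : P) (x : PString) : Set where
    field
      rank     : ℕ
      fce-≡    : fce (pc α ∷ x) ≡ num (suc rank)
      encode-≡ : ⟨ pc α ∷ x ⟩ ≡ ∞ ∷ replace∞ rank 1 ⟨ x ⟩
      select-≡ : rank < count∞ ⟨ x ⟩ → select (pc α) x 1 ≡ just (suc (index∞ rank ⟨ x ⟩))

  pHeadView-absent : ∀ α x → Fresh (pc α) x → PHeadView α x
  pHeadView-absent α x fresh = record
    { rank     = count∞ ⟨ x ⟩
    ; fce-≡    = trans (fce-pc-absent α x fresh)
                       (cong num (trans (∣∣ₚ≡count∞ (pc α ∷ x)) (cong (suc ∘ count∞) unchanged)))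
    ; encode-≡ = cong (∞ ∷_) (trans unchanged (≡.sym (replace∞-beyond _ 1 ⟨ x ⟩ ≤-refl)))
    ; select-≡ = λ rank<rank → ⊥-elim (<-irrefl refl rank<rank)
    }
    where
    unchanged : encGo (pc α ∷ []) x ≡ ⟨ x ⟩
    unchanged = encGo-after-absent x fresh

  pHeadView-first : ∀ α u v → Fresh (pc α) u → PHeadView α (u ++ pc α ∷ v)
  pHeadView-first α u v fresh = record
    { rank     = count∞ ⟨ u ⟩
    ; fce-≡    = begin
        fce (pc α ∷ u ++ pc α ∷ v)                     ≡⟨ fce-pc-recurring α (u ++ pc α ∷ v) (select-first u v fresh) ⟩
        num ∣ pc α ∷ take (suc (length u)) (u ++ pc α ∷ v) ∣ₚ
                                                       ≡⟨ cong (λ w → num ∣ pc α ∷ w ∣ₚ) (take-∷ʳ u (pc α) v) ⟩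
        num ∣ pc α ∷ u ++ pc α ∷ [] ∣ₚ                  ≡⟨ cong num (∣∣ₚ≡count∞ (pc α ∷ u ++ pc α ∷ [])) ⟩
        num (suc (count∞ (encGo (pc α ∷ []) (u ++ pc α ∷ []))))
                                                       ≡⟨ cong (num ∘ suc ∘ count∞) (encGo-after-first u [] fresh) ⟩
        num (suc (count∞ (⟨ u ⟩ ++ num _ ∷ [])))         ≡⟨ cong (num ∘ suc) (count∞-++ ⟨ u ⟩ _) ⟩
        num (suc (count∞ ⟨ u ⟩ + 0))                     ≡⟨ cong (num ∘ suc) (+-identityʳ _) ⟩
        num (suc (count∞ ⟨ u ⟩))                         ∎
    ; encode-≡ = cong (∞ ∷_) $ begin
        encGo (pc α ∷ []) (u ++ pc α ∷ v)              ≡⟨ encGo-after-first u v fresh ⟩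
        ⟨ u ⟩ ++ num (suc (length u)) ∷ T               ≡⟨ cong (λ k → ⟨ u ⟩ ++ num (suc k) ∷ T) (≡.sym (length-encGo [] u)) ⟩
        ⟨ u ⟩ ++ num (1 + length ⟨ u ⟩) ∷ T              ≡⟨ ≡.sym (replace∞-split ⟨ u ⟩ T 1) ⟩
        replace∞ (count∞ ⟨ u ⟩) 1 (⟨ u ⟩ ++ ∞ ∷ T)        ≡⟨ cong (replace∞ _ 1) (≡.sym (encode-first u v fresh)) ⟩
        replace∞ (count∞ ⟨ u ⟩) 1 ⟨ u ++ pc α ∷ v ⟩       ∎
    ; select-≡ = λ _ → trans (select-first u v fresh) (cong (just ∘ suc) (≡.sym position))
    }
    where
    open ≡-Reasoning
    T : List Sym
    T = encGo (pc α ∷ u ʳ++ []) v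
    position : index∞ (count∞ ⟨ u ⟩) ⟨ u ++ pc α ∷ v ⟩ ≡ length u
    position = trans (cong (index∞ _) (encode-first u v fresh))
                     (trans (index∞-split ⟨ u ⟩ T) (length-encGo [] u))

  pHeadView : ∀ α x → PHeadView α x
  pHeadView α x with occurrence (pc α) x
  ... | absent fresh = pHeadView-absent α x fresh
  ... | first u v fresh = pHeadView-first α u v fresh

  <ᵉ-irrefl : ∀ {a b} → a <ᵉ b → a ≢ b
  <ᵉ-irrefl (s<s a<a) refl = IsStrictTotalOrder.irrefl <ₛ-isSTO refl a<a
  <ᵉ-irrefl (n<n i<i) refl = <-irrefl refl i<i

  commonPrefix-∷-≡ : ∀ a u v → commonPrefix (a ∷ u) (a ∷ v) ≡ a ∷ commonPrefix u v
  commonPrefix-∷-≡ a u v with a ≟ᵉ a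
  ... | yes _ = refl
  ... | no a≢a = ⊥-elim (a≢a refl)

  commonPrefix-∷-≢ : ∀ {a b} u v → a ≢ b → commonPrefix (a ∷ u) (b ∷ v) ≡ []
  commonPrefix-∷-≢ {a} {b} u v a≢b with a ≟ᵉ b
  ... | yes a≡b = ⊥-elim (a≢b a≡b)
  ... | no _ = refl

  commonPrefix-comm : ∀ u v → commonPrefix u v ≡ commonPrefix v u
  commonPrefix-comm [] [] = refl
  commonPrefix-comm [] (_ ∷ _) = refl
  commonPrefix-comm (_ ∷ _) [] = refl
  commonPrefix-comm (a ∷ u) (b ∷ v) with a ≟ᵉ b | b ≟ᵉ a
  ... | yes refl | yes _    = cong (a ∷_) (commonPrefix-comm u v)
  ... | yes refl | no a≢a   = ⊥-elim (a≢a refl)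
  ... | no a≢a   | yes refl = ⊥-elim (a≢a refl)
  ... | no _     | no _     = refl

  count∞-commonPrefix : ∀ u v → count∞ (commonPrefix u v) ≤ count∞ u
  count∞-commonPrefix [] v = z≤n
  count∞-commonPrefix (a ∷ u) [] = z≤n
  count∞-commonPrefix (a ∷ u) (b ∷ v) with a ≟ᵉ b
  ... | no _ = z≤n
  count∞-commonPrefix (sym _ ∷ u) (b ∷ v) | yes refl = count∞-commonPrefix u v
  count∞-commonPrefix (num _ ∷ u) (b ∷ v) | yes refl = count∞-commonPrefix u v
  count∞-commonPrefix (∞ ∷ u) (b ∷ v)     | yes refl = s≤s (count∞-commonPrefix u v)

  replace∞-within-commonPrefix : ∀ i p {P Q} → P <ₗ Q → i < count∞ (commonPrefix P Q) →
    commonPrefix (replace∞ i p P) (replace∞ i p Q) ≡ replace∞ i p (commonPrefix P Q)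
    × replace∞ i p P <ₗ replace∞ i p Q
  replace∞-within-commonPrefix i p (head< {u = u} {v} a<b) i<e =
    case subst (λ c → i < count∞ c) (commonPrefix-∷-≢ u v (<ᵉ-irrefl a<b)) i<e of λ ()
  replace∞-within-commonPrefix i p (tail< {a} {P} {Q} P<Q) i<e
    rewrite commonPrefix-∷-≡ a P Q = step a i i<e
    where
    continue : ∀ a i → i < count∞ (commonPrefix P Q) →
      commonPrefix (a ∷ replace∞ i (suc p) P) (a ∷ replace∞ i (suc p) Q)
        ≡ a ∷ replace∞ i (suc p) (commonPrefix P Q)
      × (a ∷ replace∞ i (suc p) P) <ₗ (a ∷ replace∞ i (suc p) Q)
    continue a i i<e =
      let cp≡ , X<Y = replace∞-within-commonPrefix i (suc p) P<Q i<e in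
      trans (commonPrefix-∷-≡ a _ _) (cong (a ∷_) cp≡) , tail< X<Y

    step : ∀ a i → i < count∞ (a ∷ commonPrefix P Q) →
      commonPrefix (replace∞ i p (a ∷ P)) (replace∞ i p (a ∷ Q)) ≡ replace∞ i p (a ∷ commonPrefix P Q)
      × replace∞ i p (a ∷ P) <ₗ replace∞ i p (a ∷ Q)
    step (sym s) i i<e = continue (sym s) i i<e
    step (num n) i i<e = continue (num n) i i<e
    step ∞ zero _ = commonPrefix-∷-≡ (num p) P Q , tail< P<Q
    step ∞ (suc i) (s≤s i<e) = continue ∞ i i<e

  replace∞-earlier : ∀ i j p P Q → i < count∞ (commonPrefix P Q) → i < j →
    let X = replace∞ i p P ; Y = replace∞ j p Q in
    length (commonPrefix X Y) ≡ index∞ i P × count∞ (commonPrefix X Y) ≡ i × X <ₗ Y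
  replace∞-earlier i j p (a ∷ P) (b ∷ Q) i<e i<j with a ≟ᵉ b
  ... | no _ = case i<e of λ ()
  ... | yes refl = step a i j i<e i<j
    where
    continue : ∀ a i j → i < count∞ (commonPrefix P Q) → i < j →
      let X = replace∞ i (suc p) P ; Y = replace∞ j (suc p) Q in
      length (commonPrefix (a ∷ X) (a ∷ Y)) ≡ suc (index∞ i P)
      × count∞ (commonPrefix (a ∷ X) (a ∷ Y)) ≡ count∞ (a ∷ []) + i × (a ∷ X) <ₗ (a ∷ Y)
    continue a i j i<e i<j rewrite commonPrefix-∷-≡ a (replace∞ i (suc p) P) (replace∞ j (suc p) Q) =
      let lcp≡ , count≡ , X<Y = replace∞-earlier i j (suc p) P Q i<e i<j in
      cong suc lcp≡ , trans (count∞-++ (a ∷ []) _) (cong (count∞ (a ∷ []) +_) count≡) , tail< X<Y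

    step : ∀ a i j → i < count∞ (a ∷ commonPrefix P Q) → i < j →
      let X = replace∞ i p (a ∷ P) ; Y = replace∞ j p (a ∷ Q) in
      length (commonPrefix X Y) ≡ index∞ i (a ∷ P) × count∞ (commonPrefix X Y) ≡ i × X <ₗ Y
    step (sym s) i j i<e i<j = continue (sym s) i j i<e i<j
    step (num n) i j i<e i<j = continue (num n) i j i<e i<j
    step ∞ zero (suc j) _ _ = refl , refl , head< n<∞
    step ∞ (suc i) (suc j) (s≤s i<e) (s≤s i<j) = continue ∞ i j i<e i<j

  -- Where the ∞ at the head of the larger list is replaced, num p still beats the head distance of the smaller.
  replace∞-heads : ∀ i j p {a b} u v → a <ᵉ b → DistancesBelow p (a ∷ u) →
    let X = replace∞ i p (a ∷ u) ; Y = replace∞ j p (b ∷ v) in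
    commonPrefix X Y ≡ [] × X <ₗ Y
  replace∞-heads i j p u v a<b@(s<s _) _ = commonPrefix-∷-≢ _ _ (<ᵉ-irrefl a<b) , head< a<b
  replace∞-heads i j p u v a<b@(n<n _) _ = commonPrefix-∷-≢ _ _ (<ᵉ-irrefl a<b) , head< a<b
  replace∞-heads i j p u v s<n _ = refl , head< s<n
  replace∞-heads i zero p u v s<∞ _ = refl , head< s<n
  replace∞-heads i (suc j) p u v s<∞ _ = refl , head< s<∞
  replace∞-heads i zero p u v n<∞ (num∷ n<p _) = commonPrefix-∷-≢ _ _ (<ᵉ-irrefl (n<n n<p)) , head< (n<n n<p)
  replace∞-heads i (suc j) p u v n<∞ _ = refl , head< n<∞

  []<ₗ-replace∞ : ∀ j p b v → [] <ₗ replace∞ j p (b ∷ v)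
  []<ₗ-replace∞ j p (sym _) v = []<∷
  []<ₗ-replace∞ j p (num _) v = []<∷
  []<ₗ-replace∞ zero p ∞ v = []<∷
  []<ₗ-replace∞ (suc j) p ∞ v = []<∷

  replace∞-beyond-commonPrefix : ∀ i j p {P Q} → P <ₗ Q → DistancesBelow p P →
    count∞ (commonPrefix P Q) ≤ i → count∞ (commonPrefix P Q) ≤ j →
    commonPrefix (replace∞ i p P) (replace∞ j p Q) ≡ commonPrefix P Q × replace∞ i p P <ₗ replace∞ j p Q
  replace∞-beyond-commonPrefix i j p ([]<∷ {b} {v}) _ _ _ = refl , []<ₗ-replace∞ j p b v
  replace∞-beyond-commonPrefix i j p (head< {u = u} {v} a<b) bounded _ _
    rewrite commonPrefix-∷-≢ u v (<ᵉ-irrefl a<b) = replace∞-heads i j p u v a<b bounded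
  replace∞-beyond-commonPrefix i j p (tail< {a} {P} {Q} P<Q) bounded e≤i e≤j
    rewrite commonPrefix-∷-≡ a P Q = step a i j bounded e≤i e≤j
    where
    continue : ∀ a i j → DistancesBelow (suc p) P →
      count∞ (commonPrefix P Q) ≤ i → count∞ (commonPrefix P Q) ≤ j →
      commonPrefix (a ∷ replace∞ i (suc p) P) (a ∷ replace∞ j (suc p) Q) ≡ a ∷ commonPrefix P Q
      × (a ∷ replace∞ i (suc p) P) <ₗ (a ∷ replace∞ j (suc p) Q)
    continue a i j bounded e≤i e≤j =
      let cp≡ , X<Y = replace∞-beyond-commonPrefix i j (suc p) P<Q bounded e≤i e≤j in
      trans (commonPrefix-∷-≡ a _ _) (cong (a ∷_) cp≡) , tail< X<Y

    step : ∀ a i j → DistancesBelow p (a ∷ P) →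
      count∞ (a ∷ commonPrefix P Q) ≤ i → count∞ (a ∷ commonPrefix P Q) ≤ j →
      commonPrefix (replace∞ i p (a ∷ P)) (replace∞ j p (a ∷ Q)) ≡ a ∷ commonPrefix P Q
      × replace∞ i p (a ∷ P) <ₗ replace∞ j p (a ∷ Q)
    step (sym s) i j (sym∷ bounded) = continue (sym s) i j bounded
    step (num n) i j (num∷ _ bounded) = continue (num n) i j bounded
    step ∞ (suc i) (suc j) (∞∷ bounded) (s≤s e≤i) (s≤s e≤j) = continue ∞ i j bounded e≤i e≤j

  equal-s-heads : ∀ s {x y} → ⟨ x ⟩ <ₗ ⟨ y ⟩ →
    lcp ⟨ sc s ∷ x ⟩ ⟨ sc s ∷ y ⟩ ≡ suc (lcp ⟨ x ⟩ ⟨ y ⟩)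
    × lcp∞ ⟨ sc s ∷ x ⟩ ⟨ sc s ∷ y ⟩ ≡ lcp∞ ⟨ x ⟩ ⟨ y ⟩
    × ⟨ sc s ∷ x ⟩ <ₗ ⟨ sc s ∷ y ⟩
  equal-s-heads s {x} {y} x<y
    rewrite encGo-after-s s x | encGo-after-s s y | commonPrefix-∷-≡ (sym s) ⟨ x ⟩ ⟨ y ⟩ =
    refl , refl , tail< x<y

  distinct-heads : ∀ {a b} u v → a ≢ b →
    lcp (a ∷ u) (b ∷ v) ≡ 0 × lcp∞ (a ∷ u) (b ∷ v) ≡ 0 × ((a ∷ u) <ₗ (b ∷ v) ⇔ a <ᵉ b)
  distinct-heads {a} {b} u v a≢b rewrite commonPrefix-∷-≢ u v a≢b = refl , refl , mk⇔ head-< head<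
    where
    head-< : (a ∷ u) <ₗ (b ∷ v) → a <ᵉ b
    head-< (head< a<b) = a<b
    head-< (tail< _) = ⊥-elim (a≢b refl)

  s-head-p-head : ∀ s x β y →
    lcp ⟨ sc s ∷ x ⟩ ⟨ pc β ∷ y ⟩ ≡ 0 × lcp∞ ⟨ sc s ∷ x ⟩ ⟨ pc β ∷ y ⟩ ≡ 0
    × (⟨ sc s ∷ x ⟩ <ₗ ⟨ pc β ∷ y ⟩ ⇔ fce (sc s ∷ x) <ᵉ fce (pc β ∷ y))
  s-head-p-head s x β y = refl , refl , mk⇔ (λ _ → s<n) (λ _ → head< s<∞)

  p-head-s-head : ∀ α x t y →
    lcp ⟨ pc α ∷ x ⟩ ⟨ sc t ∷ y ⟩ ≡ 0 × lcp∞ ⟨ pc α ∷ x ⟩ ⟨ sc t ∷ y ⟩ ≡ 0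
    × (⟨ pc α ∷ x ⟩ <ₗ ⟨ sc t ∷ y ⟩ ⇔ fce (pc α ∷ x) <ᵉ fce (sc t ∷ y))
  p-head-s-head α x t y = refl , refl , mk⇔ (λ { (head< ()) }) λ ()

  num-suc≤ᵉnum⇒< : ∀ {i e} → num (suc i) ≤ᵉ num e → i < e
  num-suc≤ᵉnum⇒< (inj₁ (n<n i<e)) = <⇒≤ i<e
  num-suc≤ᵉnum⇒< (inj₂ refl) = ≤-refl

  num-suc<ᵉnum-suc⇒< : ∀ {i j} → num (suc i) <ᵉ num (suc j) → i < j
  num-suc<ᵉnum-suc⇒< (n<n (s≤s i<j)) = i<j

  num<ᵉnum-suc⇒≤ : ∀ {e i} → num e <ᵉ num (suc i) → e ≤ i
  num<ᵉnum-suc⇒≤ (n<n (s≤s e≤i)) = e≤i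

  module TwoPHeads {α β x y} (vx : PHeadView α x) (vy : PHeadView β y) (x<y : ⟨ x ⟩ <ₗ ⟨ y ⟩) where
    open PHeadView vx renaming (rank to i; fce-≡ to fce-x; encode-≡ to encode-x; select-≡ to select-x)
    open PHeadView vy renaming (rank to j; fce-≡ to fce-y; encode-≡ to encode-y; select-≡ to select-y)

    X Y : List Sym
    X = replace∞ i 1 ⟨ x ⟩
    Y = replace∞ j 1 ⟨ y ⟩

    e : ℕ
    e = lcp∞ ⟨ x ⟩ ⟨ y ⟩

    lcp-encode : lcp ⟨ pc α ∷ x ⟩ ⟨ pc β ∷ y ⟩ ≡ suc (lcp X Y)
    lcp-encode = cong₂ lcp encode-x encode-y

    lcp∞-encode : lcp∞ ⟨ pc α ∷ x ⟩ ⟨ pc β ∷ y ⟩ ≡ suc (lcp∞ X Y)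
    lcp∞-encode = cong₂ lcp∞ encode-x encode-y

    <ₗ-encode : X <ₗ Y → ⟨ pc α ∷ x ⟩ <ₗ ⟨ pc β ∷ y ⟩
    <ₗ-encode X<Y = subst₂ _<ₗ_ (≡.sym encode-x) (≡.sym encode-y) (tail< X<Y)

    i<e : fce (pc α ∷ x) ≤ᵉ num e → i < e
    i<e fce≤e = num-suc≤ᵉnum⇒< (subst (_≤ᵉ num e) fce-x fce≤e)

    j<e : fce (pc β ∷ y) ≤ᵉ num e → j < e
    j<e fce≤e = num-suc≤ᵉnum⇒< (subst (_≤ᵉ num e) fce-y fce≤e)

    same-rank : fce (pc α ∷ x) ≡ fce (pc β ∷ y) → fce (pc α ∷ x) ≤ᵉ num e →
      lcp ⟨ pc α ∷ x ⟩ ⟨ pc β ∷ y ⟩ ≡ suc (lcp ⟨ x ⟩ ⟨ y ⟩)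
      × lcp∞ ⟨ pc α ∷ x ⟩ ⟨ pc β ∷ y ⟩ ≡ e
      × ⟨ pc α ∷ x ⟩ <ₗ ⟨ pc β ∷ y ⟩
    same-rank fce≡ fce≤e with refl ← trans (≡.sym fce-x) (trans fce≡ fce-y) =
      let cp≡ , X<Y = replace∞-within-commonPrefix i 1 x<y (i<e fce≤e) in
      trans lcp-encode (cong suc (trans (cong length cp≡) (length-replace∞ i 1 cp))) ,
      trans lcp∞-encode (trans (cong (suc ∘ count∞) cp≡) (count∞-replace∞ i 1 cp (i<e fce≤e))) ,
      <ₗ-encode X<Y
      where
      cp : List Sym
      cp = commonPrefix ⟨ x ⟩ ⟨ y ⟩

    x-rank-earlier : fce (pc α ∷ x) ≤ᵉ num e → fce (pc α ∷ x) <ᵉ fce (pc β ∷ y) →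
      select (pc α) x 1 ≡ just (lcp ⟨ pc α ∷ x ⟩ ⟨ pc β ∷ y ⟩)
      × num (lcp∞ ⟨ pc α ∷ x ⟩ ⟨ pc β ∷ y ⟩) ≡ fce (pc α ∷ x)
      × ⟨ pc α ∷ x ⟩ <ₗ ⟨ pc β ∷ y ⟩
    x-rank-earlier fce≤e fce< =
      let lcp≡ , count≡ , X<Y = replace∞-earlier i j 1 ⟨ x ⟩ ⟨ y ⟩ (i<e fce≤e) i<j in
      trans (select-x (≤-trans (i<e fce≤e) (count∞-commonPrefix ⟨ x ⟩ ⟨ y ⟩)))
            (cong just (≡.sym (trans lcp-encode (cong suc lcp≡)))) ,
      trans (cong num (trans lcp∞-encode (cong suc count≡))) (≡.sym fce-x) ,
      <ₗ-encode X<Y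
      where
      i<j : i < j
      i<j = num-suc<ᵉnum-suc⇒< (subst₂ _<ᵉ_ fce-x fce-y fce<)

    y-rank-earlier : fce (pc β ∷ y) ≤ᵉ num e → fce (pc β ∷ y) <ᵉ fce (pc α ∷ x) →
      select (pc β) y 1 ≡ just (lcp ⟨ pc α ∷ x ⟩ ⟨ pc β ∷ y ⟩)
      × num (lcp∞ ⟨ pc α ∷ x ⟩ ⟨ pc β ∷ y ⟩) ≡ fce (pc β ∷ y)
      × ⟨ pc β ∷ y ⟩ <ₗ ⟨ pc α ∷ x ⟩
    y-rank-earlier fce≤e fce< =
      let lcp≡ , count≡ , Y<X = replace∞-earlier j i 1 ⟨ y ⟩ ⟨ x ⟩ j<e′ j<i in
      trans (select-y (≤-trans j<e′ (count∞-commonPrefix ⟨ y ⟩ ⟨ x ⟩)))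
            (cong just (≡.sym (trans lcp-encode (cong suc (trans (cong length cp-comm) lcp≡))))) ,
      trans (cong num (trans lcp∞-encode (cong suc (trans (cong count∞ cp-comm) count≡)))) (≡.sym fce-y) ,
      subst₂ _<ₗ_ (≡.sym encode-y) (≡.sym encode-x) (tail< Y<X)
      where
      j<e′ : j < count∞ (commonPrefix ⟨ y ⟩ ⟨ x ⟩)
      j<e′ = subst (λ c → j < count∞ c) (commonPrefix-comm ⟨ x ⟩ ⟨ y ⟩) (j<e fce≤e)
      j<i : j < i
      j<i = num-suc<ᵉnum-suc⇒< (subst₂ _<ᵉ_ fce-y fce-x fce<)
      cp-comm : commonPrefix X Y ≡ commonPrefix Y X
      cp-comm = commonPrefix-comm X Y

    both-ranks-beyond : num e <ᵉ fce (pc α ∷ x) → num e <ᵉ fce (pc β ∷ y) →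
      lcp ⟨ pc α ∷ x ⟩ ⟨ pc β ∷ y ⟩ ≡ suc (lcp ⟨ x ⟩ ⟨ y ⟩)
      × lcp∞ ⟨ pc α ∷ x ⟩ ⟨ pc β ∷ y ⟩ ≡ suc e
      × ⟨ pc α ∷ x ⟩ <ₗ ⟨ pc β ∷ y ⟩
    both-ranks-beyond e<fce-x e<fce-y =
      let cp≡ , X<Y = replace∞-beyond-commonPrefix i j 1 x<y (encGo-distancesBelow [] x) e≤i e≤j in
      trans lcp-encode (cong (suc ∘ length) cp≡) ,
      trans lcp∞-encode (cong (suc ∘ count∞) cp≡) ,
      <ₗ-encode X<Y
      where
      e≤i : e ≤ i
      e≤i = num<ᵉnum-suc⇒≤ (subst (num e <ᵉ_) fce-x e<fce-x)
      e≤j : e ≤ j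
      e≤j = num<ᵉnum-suc⇒≤ (subst (num e <ᵉ_) fce-y e<fce-y)

open PStrings using (sc; pc)

lemma3 : (A : PAlphabet) → let open PStrings A in
  (a : Char) (x' : PString) (b : Char) (y' : PString) →
  ⟨ x' ⟩ <ₗ ⟨ y' ⟩ →
  ((IsS (fce (a ∷ x')) ⊎ IsS (fce (b ∷ y'))) →
    (fce (a ∷ x') ≢ fce (b ∷ y') →
      lcp ⟨ a ∷ x' ⟩ ⟨ b ∷ y' ⟩ ≡ 0 × lcp∞ ⟨ a ∷ x' ⟩ ⟨ b ∷ y' ⟩ ≡ 0
      × (⟨ a ∷ x' ⟩ <ₗ ⟨ b ∷ y' ⟩ ⇔ fce (a ∷ x') <ᵉ fce (b ∷ y')))
    × (fce (a ∷ x') ≡ fce (b ∷ y') →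
      lcp ⟨ a ∷ x' ⟩ ⟨ b ∷ y' ⟩ ≡ suc (lcp ⟨ x' ⟩ ⟨ y' ⟩)
      × lcp∞ ⟨ a ∷ x' ⟩ ⟨ b ∷ y' ⟩ ≡ lcp∞ ⟨ x' ⟩ ⟨ y' ⟩
      × ⟨ a ∷ x' ⟩ <ₗ ⟨ b ∷ y' ⟩))
  × (¬ IsS (fce (a ∷ x')) → ¬ IsS (fce (b ∷ y')) →
    (fce (a ∷ x') ≡ fce (b ∷ y') → fce (a ∷ x') ≤ᵉ num (lcp∞ ⟨ x' ⟩ ⟨ y' ⟩) →
      lcp ⟨ a ∷ x' ⟩ ⟨ b ∷ y' ⟩ ≡ suc (lcp ⟨ x' ⟩ ⟨ y' ⟩)
      × lcp∞ ⟨ a ∷ x' ⟩ ⟨ b ∷ y' ⟩ ≡ lcp∞ ⟨ x' ⟩ ⟨ y' ⟩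
      × ⟨ a ∷ x' ⟩ <ₗ ⟨ b ∷ y' ⟩)
    × (fce (a ∷ x') ≤ᵉ num (lcp∞ ⟨ x' ⟩ ⟨ y' ⟩) → fce (a ∷ x') <ᵉ fce (b ∷ y') →
      select a x' 1 ≡ just (lcp ⟨ a ∷ x' ⟩ ⟨ b ∷ y' ⟩)
      × num (lcp∞ ⟨ a ∷ x' ⟩ ⟨ b ∷ y' ⟩) ≡ fce (a ∷ x')
      × ⟨ a ∷ x' ⟩ <ₗ ⟨ b ∷ y' ⟩)
    × (fce (b ∷ y') ≤ᵉ num (lcp∞ ⟨ x' ⟩ ⟨ y' ⟩) → fce (b ∷ y') <ᵉ fce (a ∷ x') →
      select b y' 1 ≡ just (lcp ⟨ a ∷ x' ⟩ ⟨ b ∷ y' ⟩)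
      × num (lcp∞ ⟨ a ∷ x' ⟩ ⟨ b ∷ y' ⟩) ≡ fce (b ∷ y')
      × ⟨ b ∷ y' ⟩ <ₗ ⟨ a ∷ x' ⟩)
    × (num (lcp∞ ⟨ x' ⟩ ⟨ y' ⟩) <ᵉ fce (a ∷ x') → num (lcp∞ ⟨ x' ⟩ ⟨ y' ⟩) <ᵉ fce (b ∷ y') →
      lcp ⟨ a ∷ x' ⟩ ⟨ b ∷ y' ⟩ ≡ suc (lcp ⟨ x' ⟩ ⟨ y' ⟩)
      × lcp∞ ⟨ a ∷ x' ⟩ ⟨ b ∷ y' ⟩ ≡ suc (lcp∞ ⟨ x' ⟩ ⟨ y' ⟩)
      × ⟨ a ∷ x' ⟩ <ₗ ⟨ b ∷ y' ⟩))
lemma3 A (sc s) x' (sc t) y' x'<y' =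
  (λ _ → distinct-heads _ _ , λ { refl → equal-s-heads s x'<y' }) , λ ¬S _ → ⊥-elim (¬S (s , refl))
lemma3 A (sc s) x' (pc β) y' _ =
  (λ _ → (λ _ → s-head-p-head s x' β y') , λ ()) , λ ¬S _ → ⊥-elim (¬S (s , refl))
lemma3 A (pc α) x' (sc t) y' _ =
  (λ _ → (λ _ → p-head-s-head α x' t y') , λ ()) , λ _ ¬S → ⊥-elim (¬S (t , refl))
lemma3 A (pc α) x' (pc β) y' x'<y' =
  (λ { (inj₁ (_ , ())) ; (inj₂ (_ , ())) }) ,
  λ _ _ → same-rank , x-rank-earlier , y-rank-earlier , both-ranks-beyond
  where open TwoPHeads (pHeadView α x') (pHeadView β y') x'<y'
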